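{- For all positive integers $d$ and $n$, $\mathrm{oh}(H_n^d)\geq d(n-2)+2$, where $H_n^d$ is the Cartesian product of $d$ copies of the complete graph $K_n$.
   Context: $\mathrm{oh}(G)$ (Odd Hadwiger number) of a finite simple graph $G$ is the largest integer $m$ for which there exist $m$ pairwise vertex-disjoint trees $Z_1,\dots,Z_m$ in $G$ and a 2-colouring $c$ of $V(Z_1)\cup\dots\cup V(Z_m)$ that is proper on each $Z_k$, such that for every $k\neq k'$ there is an edge $xy\in E(G)$ with $x\in V(Z_k)$, $y\in V(Z_{k'})$, $c(x)=c(y)$. The Cartesian product $G\square H$ has vertex set $V(G)\times V(H)$, with $(v_1,u_1)\sim(v_2,u_2)$ iff ($v_1=v_2$ and $u_1u_2\in E(H)$) or ($u_1=u_2$ and $v_1v_2\in E(G)$). The Hamming graph $H_n^d$ is $K_n\square\cdots\square K_n$ ($d$ factors). -}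

module Defs where

open import Level using (0ℓ)
open import Data.Nat using (ℕ; zero; suc; _<_)
open import Data.Fin using (Fin; toℕ)
open import Data.Bool using (Bool)
open import Data.Product using (Σ; ∃; ∃-syntax; _×_; _,_; proj₁)
open import Data.Sum using (_⊎_)
open import Relation.Binary.PropositionalEquality using (_≡_; _≢_)
open import Relation.Nullary using (¬_)

record Graph : Set₁ where
  field
    V     : Set
    Adj   : V → V → Set
    sym   : ∀ {x y} → Adj x y → Adj y x
    irref : ∀ {x} → ¬ Adj x x
open Graph public

K : ℕ → Graph
K n = record
  { V = Fin n
  ; Adj = λ x y → x ≢ y
  ; sym = λ p q → p (Relation.Binary.PropositionalEquality.sym q)
  ; irref = λ p → p Relation.Binary.PropositionalEquality.refl
  }

_□_ : Graph → Graph → Graph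
G □ H = record
  { V = V G × V H
  ; Adj = λ { (v₁ , u₁) (v₂ , u₂) →
              (v₁ ≡ v₂ × Adj H u₁ u₂) ⊎ (u₁ ≡ u₂ × Adj G v₁ v₂) }
  ; sym = λ { (Data.Sum.inj₁ (e , a)) → Data.Sum.inj₁ (Relation.Binary.PropositionalEquality.sym e , Graph.sym H a)
            ; (Data.Sum.inj₂ (e , a)) → Data.Sum.inj₂ (Relation.Binary.PropositionalEquality.sym e , Graph.sym G a) }
  ; irref = λ { (Data.Sum.inj₁ (_ , a)) → irref H a
              ; (Data.Sum.inj₂ (_ , a)) → irref G a }
  }

-- Hamming graph with (suc d) factors: K_n □ (K_n □ (... □ K_n)).
HammingS : ℕ → ℕ → Graph
HammingS n zero    = K n
HammingS n (suc d) = K n □ HammingS n d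

Hamming : (n d : ℕ) → .(0 < d) → Graph
Hamming n (suc d) _ = HammingS n d

-- Tree k has vertices vert k 0, ..., vert k (size k); every non-root
-- vertex i has a parent j with toℕ j < toℕ i adjacent to it in G; the
-- edges of tree k are exactly these parent edges (so it is a tree).
record OddCliqueModel (G : Graph) (m : ℕ) : Set where
  field
    size   : Fin m → ℕ
    vert   : (k : Fin m) → Fin (suc (size k)) → V G
    parent : (k : Fin m) (i : Fin (suc (size k))) → 0 < toℕ i →
             Σ (Fin (suc (size k))) λ j → toℕ j < toℕ i × Adj G (vert k i) (vert k j)
    injective : ∀ k i j → vert k i ≡ vert k j → i ≡ j
    disjoint  : ∀ k k' i j → k ≢ k' → vert k i ≢ vert k' j
    colour : V G → Bool
    proper : ∀ k i (p : 0 < toℕ i) →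
             colour (vert k i) ≢ colour (vert k (proj₁ (parent k i p)))
    odd    : ∀ k k' → k ≢ k' →
             ∃[ i ] ∃[ j ] (Adj G (vert k i) (vert k' j) ×
                            colour (vert k i) ≡ colour (vert k' j))

open import Data.Integer using (ℤ; +_; _≤_)
ohAtLeast : Graph → ℤ → Set
ohAtLeast G b = ∃[ m ] (OddCliqueModel G m × b ≤ + m)

{-# OPTIONS --safe #-}
-- Let T₀, T₁, …, Tₘ be an odd clique model in G and put it in layer 0 of K_{n+1} □ G. Each Tₖ
-- (k ≥ 1) has a vertex xₖ joined to some yₖ ∈ T₀ by an edge with equal colours; extend Tₖ by
-- the n leaves (a, xₖ), a ≠ 0. In every layer a ≠ 0 place a copy of T₀ with all colours
-- flipped. Two copies of T₀ meet along the edge between their roots, and the extended Tₖ meets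
-- the copy in layer a along (a, xₖ)(a, yₖ), both colours flipped. Hence
-- oh(K_{n+1} □ G) ≥ oh(G) + n − 1; starting from the N single vertices of K_N, every further
-- factor K_N adds N − 2.
module Submission where

open import Defs
open import Data.Nat using (ℕ; _<_)
open import Data.Integer using (+_; _+_; _*_; _-_)

open import Data.Bool using (Bool; true; not)
open import Data.Bool.Properties using (not-injective; not-¬)
open import Data.Empty using (⊥; ⊥-elim)
open import Relation.Nullary using (¬_)
open import Data.Fin using (Fin; zero; suc; toℕ; splitAt; join; _↑ˡ_; _↑ʳ_)
open import Data.Fin.Properties
  using (0≢1+n; suc-injective; toℕ<n; toℕ-↑ˡ; toℕ-↑ʳ; splitAt-↑ˡ; splitAt-↑ʳ; join-splitAt; +↔⊎)
import Data.Integer as ℤ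
import Data.Integer.Properties as ℤ
open import Data.Nat as ℕ using (zero; suc)
import Data.Nat.Properties as ℕ
open import Data.Product using (Σ; ∃-syntax; _×_; _,_; proj₁; proj₂; map₂)
open import Data.Product.Properties using (,-injectiveˡ; ,-injectiveʳ)
open import Data.Sum using (_⊎_; inj₁; inj₂; [_,_]′)
open import Function using (_∘_; id)
open import Function.Bundles using (Injection)
open import Function.Definitions using (Injective)
open import Function.Properties.Inverse using (↔⇒↣)
open import Relation.Binary.PropositionalEquality
  using (_≡_; _≢_; refl; trans; cong; subst; subst₂; module ≡-Reasoning)
  renaming (sym to ≡-sym)

private
  variable
    G H : Graph
    I J : Set
    m n : ℕ

record RootedTree (G : Graph) : Set where
  field
    size   : ℕ
    vert   : Fin (suc size) → V G
    parent : (i : Fin (suc size)) → 0 < toℕ i →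
             Σ (Fin (suc size)) λ j → toℕ j < toℕ i × Adj G (vert i) (vert j)
    vert-injective : Injective _≡_ _≡_ vert

open RootedTree

infix 4 _∈ᵗ_

record _∈ᵗ_ {G : Graph} (v : V G) (T : RootedTree G) : Set where
  constructor _,_
  field
    index   : Fin (suc (size T))
    located : vert T index ≡ v

open _∈ᵗ_

Disjoint : RootedTree G → RootedTree G → Set
Disjoint T T' = ∀ {v} → v ∈ᵗ T → v ∈ᵗ T' → ⊥

record ProperlyColoured {G : Graph} (c : V G → Bool) (T : RootedTree G) : Set where
  constructor properly
  field
    parent-colour≢ : ∀ i (p : 0 < toℕ i) → c (vert T i) ≢ c (vert T (proj₁ (parent T i p)))

record OddEdge {G : Graph} (c : V G → Bool) (T T' : RootedTree G) : Set where
  constructor oddEdge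
  field
    {x y}      : V G
    x∈T        : x ∈ᵗ T
    y∈T'       : y ∈ᵗ T'
    adjacent   : Adj G x y
    sameColour : c x ≡ c y

OddEdge-sym : ∀ {c : V G → Bool} {T T' : RootedTree G} → OddEdge c T T' → OddEdge c T' T
OddEdge-sym {G} (oddEdge x∈T y∈T' xy cx≡cy) = oddEdge y∈T' x∈T (Graph.sym G xy) (≡-sym cx≡cy)

record OddModel (G : Graph) (I : Set) : Set where
  field
    tree     : I → RootedTree G
    colour   : V G → Bool
    proper   : ∀ k → ProperlyColoured colour (tree k)
    disjoint : ∀ {k k'} → k ≢ k' → Disjoint (tree k) (tree k')
    odd      : ∀ {k k'} → k ≢ k' → OddEdge colour (tree k) (tree k')

fromOddCliqueModel : OddCliqueModel G m → OddModel G (Fin m)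
fromOddCliqueModel {G} M = record
  { tree     = tree
  ; colour   = M.colour
  ; proper   = λ k → properly (M.proper k)
  ; disjoint = λ k≢k' → λ { (i , refl) (j , e) → M.disjoint _ _ i j k≢k' (≡-sym e) }
  ; odd      = λ {k} {k'} k≢k' →
      let i , j , xy , cx≡cy = M.odd k k' k≢k' in oddEdge (i , refl) (j , refl) xy cx≡cy
  }
  where
  module M = OddCliqueModel M
  tree : Fin _ → RootedTree G
  tree k = record
    { size = M.size k ; vert = M.vert k ; parent = M.parent k ; vert-injective = M.injective k _ _ }

toOddCliqueModel : OddModel G (Fin m) → OddCliqueModel G m
toOddCliqueModel {G} M = record
  { size      = size ∘ M.tree
  ; vert      = vert ∘ M.tree
  ; parent    = parent ∘ M.tree
  ; injective = λ k i j → vert-injective (M.tree k)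
  ; disjoint  = λ k k' i j k≢k' e → M.disjoint k≢k' (i , refl) (j , ≡-sym e)
  ; colour    = M.colour
  ; proper    = ProperlyColoured.parent-colour≢ ∘ M.proper
  ; odd       = λ k k' k≢k' → indices (M.odd k≢k')
  }
  where
  module M = OddModel M
  indices : ∀ {T T'} → OddEdge M.colour T T' →
            ∃[ i ] ∃[ j ] (Adj G (vert T i) (vert T' j) × M.colour (vert T i) ≡ M.colour (vert T' j))
  indices (oddEdge (i , refl) (j , refl) xy cx≡cy) = i , j , xy , cx≡cy

reindex : (f : J → I) → Injective _≡_ _≡_ f → OddModel G I → OddModel G J
reindex f f-injective M = record
  { tree     = M.tree ∘ f
  ; colour   = M.colour
  ; proper   = M.proper ∘ f
  ; disjoint = λ k≢k' → M.disjoint (k≢k' ∘ f-injective)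
  ; odd      = λ k≢k' → M.odd (k≢k' ∘ f-injective)
  }
  where module M = OddModel M

point : V G → RootedTree G
point v = record
  { size = 0
  ; vert = λ _ → v
  ; parent = λ { zero () }
  ; vert-injective = λ { {zero} {zero} _ → refl }
  }

point-properlyColoured : ∀ {c : V G → Bool} {v} → ProperlyColoured c (point {G} v)
point-properlyColoured = properly λ { zero () }

complete-oddModel : ∀ n → OddModel (K n) (Fin n)
complete-oddModel n = record
  { tree     = point
  ; colour   = λ _ → true
  ; proper   = λ _ → point-properlyColoured
  ; disjoint = λ { k≢k' (zero , e) (zero , refl) → k≢k' e }
  ; odd      = λ k≢k' → oddEdge (zero , refl) (zero , refl) k≢k' refl
  }

singleton-oddModel : V G → OddModel G (Fin 1)
singleton-oddModel {G} v = record
  { tree     = λ _ → point v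
  ; colour   = λ _ → true
  ; proper   = λ _ → point-properlyColoured
  ; disjoint = λ { {zero} {zero} 0≢0 → ⊥-elim (0≢0 refl) }
  ; odd      = λ { {zero} {zero} 0≢0 → ⊥-elim (0≢0 refl) }
  }

module _ (f : V G → V H) (f-adjacent : ∀ {x y} → Adj G x y → Adj H (f x) (f y))
         (f-injective : Injective _≡_ _≡_ f) where

  mapTree : RootedTree G → RootedTree H
  mapTree T = record
    { size           = size T
    ; vert           = f ∘ vert T
    ; parent         = λ i p → map₂ (map₂ f-adjacent) (parent T i p)
    ; vert-injective = vert-injective T ∘ f-injective
    }

module Layer (H : Graph) {G : Graph} where

  -- Opaque so that unification can recover a and T from layer a T.
  opaque
    layer : V H → RootedTree G → RootedTree (H □ G)
    layer a = mapTree (a ,_) (λ xy → inj₁ (refl , xy)) ,-injectiveʳ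

    layer-properlyColoured : ∀ {c : V G → Bool} {c' : V (H □ G) → Bool} {T : RootedTree G} a →
                             (∀ {x y} → c x ≢ c y → c' (a , x) ≢ c' (a , y)) →
                             ProperlyColoured c T → ProperlyColoured c' (layer a T)
    layer-properlyColoured a preserves (properly c-proper) = properly λ i p → preserves (c-proper i p)

    ∈-layer⁺ : ∀ {a u} {T : RootedTree G} → u ∈ᵗ T → (a , u) ∈ᵗ layer a T
    ∈-layer⁺ (i , e) = i , cong (_ ,_) e

    ∈-layer⁻ : ∀ {a b u} {T : RootedTree G} → (b , u) ∈ᵗ layer a T → a ≡ b × u ∈ᵗ T
    ∈-layer⁻ (i , e) = ,-injectiveˡ e , (i , ,-injectiveʳ e)

data SplitView (m n : ℕ) : Fin (m ℕ.+ n) → Set where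
  left  : (i : Fin m) → SplitView m n (i ↑ˡ n)
  right : (j : Fin n) → SplitView m n (m ↑ʳ j)

splitView : ∀ m n (i : Fin (m ℕ.+ n)) → SplitView m n i
splitView m n i = subst (SplitView m n) (join-splitAt m n i) (viewJoin (splitAt m i))
  where
  viewJoin : (s : Fin m ⊎ Fin n) → SplitView m n (join m n s)
  viewJoin (inj₁ i) = left i
  viewJoin (inj₂ j) = right j

module AttachLeaves (T : RootedTree G) {x : V G} (x∈T : x ∈ᵗ T) (w : Fin n → V G)
         (w-adjacent : ∀ b → Adj G (w b) x) (w-injective : Injective _≡_ _≡_ w)
         (w-fresh : ∀ b → ¬ w b ∈ᵗ T) where

  private
    s : ℕ
    s = suc (size T)
    i₀ : Fin s
    i₀ = index x∈T

  vert⁺ : Fin (s ℕ.+ n) → V G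
  vert⁺ = [ vert T , w ]′ ∘ splitAt s

  vert⁺-old : ∀ i → vert⁺ (i ↑ˡ n) ≡ vert T i
  vert⁺-old i = cong [ vert T , w ]′ (splitAt-↑ˡ s i n)

  vert⁺-new : ∀ b → vert⁺ (s ↑ʳ b) ≡ w b
  vert⁺-new b = cong [ vert T , w ]′ (splitAt-↑ʳ s n b)

  vert⁺-attach : vert⁺ (i₀ ↑ˡ n) ≡ x
  vert⁺-attach = trans (vert⁺-old i₀) (located x∈T)

  parentAt : ∀ {i} → SplitView s n i → 0 < toℕ i →
             Σ (Fin (s ℕ.+ n)) λ j → toℕ j < toℕ i × Adj G (vert⁺ i) (vert⁺ j)
  parentAt (left i) p =
    let j , j<i , ij = parent T i (subst (0 <_) (toℕ-↑ˡ i n) p)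
    in j ↑ˡ n
     , subst₂ _<_ (≡-sym (toℕ-↑ˡ j n)) (≡-sym (toℕ-↑ˡ i n)) j<i
     , subst₂ (Adj G) (≡-sym (vert⁺-old i)) (≡-sym (vert⁺-old j)) ij
  parentAt (right b) _ =
    i₀ ↑ˡ n
    , subst₂ _<_ (≡-sym (toℕ-↑ˡ i₀ n)) (≡-sym (toℕ-↑ʳ s b)) (ℕ.<-≤-trans (toℕ<n i₀) (ℕ.m≤m+n s (toℕ b)))
    , subst₂ (Adj G) (≡-sym (vert⁺-new b)) (≡-sym vert⁺-attach) (w-adjacent b)

  tree : RootedTree G
  tree = record
    { size           = size T ℕ.+ n
    ; vert           = vert⁺
    ; parent         = λ i → parentAt (splitView s n i)
    ; vert-injective = λ {i} {j} → injectiveAt (splitView s n i) (splitView s n j)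
    }
    where
    injectiveAt : ∀ {i j} → SplitView s n i → SplitView s n j → vert⁺ i ≡ vert⁺ j → i ≡ j
    injectiveAt (left i) (left j) e =
      cong (_↑ˡ n) (vert-injective T (trans (≡-sym (vert⁺-old i)) (trans e (vert⁺-old j))))
    injectiveAt (left i) (right b) e =
      ⊥-elim (w-fresh b (i , trans (≡-sym (vert⁺-old i)) (trans e (vert⁺-new b))))
    injectiveAt (right a) (left j) e =
      ⊥-elim (w-fresh a (j , trans (≡-sym (vert⁺-old j)) (trans (≡-sym e) (vert⁺-new a))))
    injectiveAt (right a) (right b) e =
      cong (s ↑ʳ_) (w-injective (trans (≡-sym (vert⁺-new a)) (trans e (vert⁺-new b))))

  properlyColoured : (c : V G → Bool) → ProperlyColoured c T → (∀ b → c (w b) ≢ c x) →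
                     ProperlyColoured c tree
  properlyColoured c (properly c-proper) c-leaf = properly λ i → properAt (splitView s n i)
    where
    properAt : ∀ {i} (v : SplitView s n i) p → c (vert⁺ i) ≢ c (vert⁺ (proj₁ (parentAt v p)))
    properAt (left i) p =
      subst₂ (λ y z → c y ≢ c z) (≡-sym (vert⁺-old i)) (≡-sym (vert⁺-old _)) (c-proper i _)
    properAt (right b) p =
      subst₂ (λ y z → c y ≢ c z) (≡-sym (vert⁺-new b)) (≡-sym vert⁺-attach) (c-leaf b)

  ∈-old : ∀ {v} → v ∈ᵗ T → v ∈ᵗ tree
  ∈-old (i , e) = i ↑ˡ n , trans (vert⁺-old i) e

  ∈-new : ∀ b → w b ∈ᵗ tree
  ∈-new b = s ↑ʳ b , vert⁺-new b

  ∈⁻ : ∀ {v} → v ∈ᵗ tree → v ∈ᵗ T ⊎ ∃[ b ] w b ≡ v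
  ∈⁻ (i , e) = memberAt (splitView s n i) e
    where
    memberAt : ∀ {i v} → SplitView s n i → vert⁺ i ≡ v → v ∈ᵗ T ⊎ ∃[ b ] w b ≡ v
    memberAt (left i) e = inj₁ (i , trans (≡-sym (vert⁺-old i)) e)
    memberAt (right b) e = inj₂ (b , trans (≡-sym (vert⁺-new b)) e)

module LayeredModel (M : OddModel G (Fin (suc m))) (n : ℕ) where
  open OddModel M
  open Layer (K (suc n))

  toCentre : (k : Fin m) → OddEdge colour (tree (suc k)) (tree zero)
  toCentre k = odd (λ ())

  module ToCentre (k : Fin m) = OddEdge (toCentre k)

  colour⁺ : V (K (suc n) □ G) → Bool
  colour⁺ (zero  , v) = colour v
  colour⁺ (suc _ , v) = not (colour v)

  layer-properlyColoured⁺ : ∀ a {T : RootedTree G} →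
                            ProperlyColoured colour T → ProperlyColoured colour⁺ (layer a T)
  layer-properlyColoured⁺ zero    = layer-properlyColoured zero id
  layer-properlyColoured⁺ (suc a) = layer-properlyColoured (suc a) (_∘ not-injective)

  module Extended (k : Fin m) = AttachLeaves {K (suc n) □ G}
    (layer zero (tree (suc k))) (∈-layer⁺ (ToCentre.x∈T k)) (λ a → suc a , ToCentre.x k)
    (λ _ → inj₂ (refl , λ ()))
    (suc-injective ∘ ,-injectiveˡ)
    (λ _ → 0≢1+n ∘ proj₁ ∘ ∈-layer⁻)

  tree⁺ : Fin m ⊎ Fin n → RootedTree (K (suc n) □ G)
  tree⁺ (inj₁ k) = Extended.tree k
  tree⁺ (inj₂ a) = layer (suc a) (tree zero)

  proper⁺ : ∀ k → ProperlyColoured colour⁺ (tree⁺ k)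
  proper⁺ (inj₁ k) = Extended.properlyColoured k colour⁺ (layer-properlyColoured⁺ zero (proper (suc k)))
                       (λ _ not-cx≡cx → not-¬ refl (≡-sym not-cx≡cx))
  proper⁺ (inj₂ a) = layer-properlyColoured⁺ (suc a) (proper zero)

  ∈-extended : ∀ {k b u} → (b , u) ∈ᵗ Extended.tree k → u ∈ᵗ tree (suc k)
  ∈-extended {k} v∈ with Extended.∈⁻ k v∈
  ... | inj₁ v∈layer  = proj₂ (∈-layer⁻ v∈layer)
  ... | inj₂ (_ , e) = subst (_∈ᵗ tree (suc k)) (,-injectiveʳ e) (ToCentre.x∈T k)

  disjoint⁺ : ∀ {k k'} → k ≢ k' → Disjoint (tree⁺ k) (tree⁺ k')
  disjoint⁺ {inj₁ k} {inj₁ k'} k≢k' p q =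
    disjoint (k≢k' ∘ cong inj₁ ∘ suc-injective) (∈-extended p) (∈-extended q)
  disjoint⁺ {inj₁ k} {inj₂ a} _ p q = disjoint (λ ()) (∈-extended p) (proj₂ (∈-layer⁻ q))
  disjoint⁺ {inj₂ a} {inj₁ k} _ p q = disjoint (λ ()) (proj₂ (∈-layer⁻ p)) (∈-extended q)
  disjoint⁺ {inj₂ a} {inj₂ b} a≢b p q =
    a≢b (cong inj₂ (suc-injective (trans (proj₁ (∈-layer⁻ p)) (≡-sym (proj₁ (∈-layer⁻ q))))))

  extended-oddEdge : ∀ {k k'} → OddEdge colour (tree (suc k)) (tree (suc k')) →
                     OddEdge colour⁺ (Extended.tree k) (Extended.tree k')
  extended-oddEdge {k} {k'} (oddEdge x∈ y∈ xy cx≡cy) =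
    oddEdge (Extended.∈-old k (∈-layer⁺ x∈)) (Extended.∈-old k' (∈-layer⁺ y∈)) (inj₁ (refl , xy)) cx≡cy

  extended-lifted-oddEdge : ∀ k a → OddEdge colour⁺ (Extended.tree k) (layer (suc a) (tree zero))
  extended-lifted-oddEdge k a =
    oddEdge (Extended.∈-new k a) (∈-layer⁺ y∈T') (inj₁ (refl , adjacent)) (cong not sameColour)
    where open ToCentre k

  odd⁺ : ∀ {k k'} → k ≢ k' → OddEdge colour⁺ (tree⁺ k) (tree⁺ k')
  odd⁺ {inj₁ k} {inj₁ k'} k≢k' = extended-oddEdge (odd (k≢k' ∘ cong inj₁ ∘ suc-injective))
  odd⁺ {inj₁ k} {inj₂ a} _     = extended-lifted-oddEdge k a
  odd⁺ {inj₂ a} {inj₁ k} _     = OddEdge-sym (extended-lifted-oddEdge k a)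
  odd⁺ {inj₂ a} {inj₂ b} a≢b   =
    oddEdge (∈-layer⁺ (zero , refl)) (∈-layer⁺ (zero , refl))
            (inj₂ (refl , a≢b ∘ cong inj₂ ∘ suc-injective)) refl

  model : OddModel (K (suc n) □ G) (Fin m ⊎ Fin n)
  model = record
    { tree = tree⁺ ; colour = colour⁺ ; proper = proper⁺ ; disjoint = disjoint⁺ ; odd = odd⁺ }

K□-oddCliqueModel : OddCliqueModel G (suc m) → OddCliqueModel (K (suc n) □ G) (m ℕ.+ n)
K□-oddCliqueModel {m = m} {n = n} M =
  toOddCliqueModel (reindex (splitAt m) (Injection.injective (↔⇒↣ +↔⊎))
                            (LayeredModel.model (fromOddCliqueModel M) n))

hamming-oddCliqueModel : ∀ n d → OddCliqueModel (HammingS (2 ℕ.+ n) d) (2 ℕ.+ suc d ℕ.* n)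
hamming-oddCliqueModel n zero =
  subst (OddCliqueModel (K (2 ℕ.+ n))) (cong (2 ℕ.+_) (≡-sym (ℕ.+-identityʳ n)))
        (toOddCliqueModel (complete-oddModel (2 ℕ.+ n)))
hamming-oddCliqueModel n (suc d) =
  subst (OddCliqueModel _) size-step (K□-oddCliqueModel (hamming-oddCliqueModel n d))
  where
  open ≡-Reasoning
  size-step : suc (suc d ℕ.* n) ℕ.+ suc n ≡ 2 ℕ.+ suc (suc d) ℕ.* n
  size-step = begin
    suc (suc d ℕ.* n ℕ.+ suc n)  ≡⟨ cong suc (ℕ.+-suc (suc d ℕ.* n) n) ⟩
    2 ℕ.+ (suc d ℕ.* n ℕ.+ n)    ≡⟨ cong (2 ℕ.+_) (ℕ.+-comm (suc d ℕ.* n) n) ⟩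
    2 ℕ.+ suc (suc d) ℕ.* n      ∎

diagonal : ∀ {n} d → Fin n → V (HammingS n d)
diagonal zero    a = a
diagonal (suc d) a = a , diagonal d a

corollary9 : (d n : ℕ) (d>0 : 0 < d) → 0 < n →
    ohAtLeast (Hamming n d d>0) ((+ d) * ((+ n) - (+ 2)) + (+ 2))
corollary9 zero    _             () _
corollary9 (suc d) zero          _  ()
corollary9 (suc d) 1             _  _  =
  1 , toOddCliqueModel (singleton-oddModel (diagonal d zero)) ,
  -- the bound computes to 2 ⊖ (1 + d * 1)
  subst (ℤ._≤ + 1) (≡-sym (ℤ.[1+m]⊖[1+n]≡m⊖n 1 (d ℕ.* 1))) (ℤ.m⊖n≤m 1 (d ℕ.* 1))
corollary9 (suc d) (suc (suc n)) _  _  =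
  2 ℕ.+ suc d ℕ.* n , hamming-oddCliqueModel n d , ℤ.≤-reflexive bound
  where
  open ≡-Reasoning
  bound : (+ suc d) * (+ n) + + 2 ≡ + (2 ℕ.+ suc d ℕ.* n)
  bound = begin
    (+ suc d) * (+ n) + + 2   ≡⟨ cong (_+ + 2) (≡-sym (ℤ.pos-* (suc d) n)) ⟩
    + (suc d ℕ.* n ℕ.+ 2)     ≡⟨ cong +_ (ℕ.+-comm (suc d ℕ.* n) 2) ⟩
    + (2 ℕ.+ suc d ℕ.* n)     ∎
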